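{- Let $\ell<m<n$ be positive integers, let $S_n=\mathrm{Sym}(\{1,\dots,n\})$, let $S_m$ be the pointwise stabilizer of $\{m+1,\dots,n\}$ in $S_n$ and $S_\ell$ the pointwise stabilizer of $\{\ell+1,\dots,n\}$ in $S_n$ (so $S_\ell<S_m<S_n$). Then $S_m$ is a perfect code of the pair $(S_n,S_\ell)$.
   Context: Graphs are finite, undirected and simple; a subset $C$ of the vertex set $V$ of a graph is a perfect code if every vertex in $V\setminus C$ is adjacent to exactly one vertex of $C$. For a group $G$, $H\leq G$ and an inverse-closed subset $U\subseteq G\setminus H$, the coset graph $\mathrm{Cos}(G,H,U)$ has vertices the left cosets of $H$ in $G$, with $xH$, $yH$ adjacent iff $x^{ -1}y\in HUH$. A subgroup $A$ with $H\leq A\leq G$ is a perfect code of the pair $(G,H)$ if for some such $U$ the set of left cosets of $H$ contained in $A$ is a perfect code in $\mathrm{Cos}(G,H,U)$. -}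

module Defs where

open import Level using (Level; _⊔_; suc; 0ℓ)
open import Data.Nat using (ℕ; _≤_)
open import Data.Fin using (Fin; toℕ)
open import Data.Fin.Permutation as P using (Permutation′; _⟨$⟩ʳ_; _⟨$⟩ˡ_)
open import Data.Product using (Σ; ∃; _×_; _,_)
open import Relation.Nullary using (¬_)
open import Relation.Binary.PropositionalEquality as Eq using (_≡_; refl; cong)
open import Algebra.Bundles using (Group)
open import Algebra.Structures using (IsGroup)

module _ {c ℓ : Level} (G : Group c ℓ) where
  open Group G

  record IsSubgroup {p : Level} (H : Carrier → Set p) : Set (c ⊔ ℓ ⊔ p) where
    field
      resp  : ∀ {x y} → x ≈ y → H x → H y
      ε∈    : H ε
      ∙-closed : ∀ {x y} → H x → H y → H (x ∙ y)
      ⁻¹-closed : ∀ {x} → H x → H (x ⁻¹)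

  module _ {p : Level} (H : Carrier → Set p) where

    InCoset : Carrier → Carrier → Set p
    InCoset x g = H (x ⁻¹ ∙ g)

    SameCoset : Carrier → Carrier → Set p
    SameCoset x y = H (x ⁻¹ ∙ y)

    DoubleCoset : (Carrier → Set p) → Carrier → Set (c ⊔ ℓ ⊔ p)
    DoubleCoset U g = Σ Carrier λ h₁ → Σ Carrier λ u → Σ Carrier λ h₂ →
      H h₁ × U u × H h₂ × (g ≈ (h₁ ∙ u) ∙ h₂)

    -- adjacency in Cos(G,H,U): xH ~ yH iff x⁻¹y ∈ HUH
    -- (vertices = left cosets, represented by elements of G)
    Adj : (Carrier → Set p) → Carrier → Carrier → Set (c ⊔ ℓ ⊔ p)
    Adj U x y = DoubleCoset U (x ⁻¹ ∙ y)

    IsPerfectCodeCos : {q : Level} → (Carrier → Set p) → (Carrier → Set q) → Set (c ⊔ ℓ ⊔ p ⊔ q)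
    IsPerfectCodeCos U C = ∀ x → ¬ C x →
      (Σ Carrier λ y → C y × Adj U x y) ×
      (∀ y y′ → C y → C y′ → Adj U x y → Adj U x y′ → SameCoset y y′)

    CosetInside : (Carrier → Set p) → Carrier → Set (c ⊔ p)
    CosetInside A x = ∀ g → InCoset x g → A g

    PerfectCodeOfPair : (Carrier → Set p) → Set (c ⊔ ℓ ⊔ suc p)
    PerfectCodeOfPair A =
      IsSubgroup H × IsSubgroup A × (∀ g → H g → A g) ×
      Σ (Carrier → Set p) λ U →
        (∀ g → U g → ¬ H g) ×
        (∀ g → U g → U (g ⁻¹)) ×
        IsPerfectCodeCos U (CosetInside A)

-- The symmetric group S_n on Fin n (= {1,…,n} shifted to {0,…,n-1}),
-- with the usual composition (σ ∙ τ)(i) = σ(τ(i)) and pointwise equality.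

module _ (n : ℕ) where
  private
    _∙_ : Permutation′ n → Permutation′ n → Permutation′ n
    σ ∙ τ = τ P.∘ₚ σ

    _≈_ = P._≈_ {n} {n}

    isGroup : IsGroup _≈_ _∙_ P.id P.flip
    isGroup = record
      { isMonoid = record
        { isSemigroup = record
          { isMagma = record
            { isEquivalence = record
              { refl = λ i → refl
              ; sym = λ e i → Eq.sym (e i)
              ; trans = λ e f i → Eq.trans (e i) (f i) }
            ; ∙-cong = λ {x} {y} {u} {v} x≈y u≈v i →
                Eq.trans (cong (x ⟨$⟩ʳ_) (u≈v i)) (x≈y (v ⟨$⟩ʳ i)) }
          ; assoc = λ x y z i → refl }
        ; identity = (λ x i → refl) , (λ x i → refl) }
      ; inverse = (λ x i → P.inverseˡ x) , (λ x i → P.inverseʳ x)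
      ; ⁻¹-cong = λ {x} {y} x≈y i →
          Eq.trans (cong (x ⟨$⟩ˡ_) (Eq.sym (Eq.trans (x≈y (y ⟨$⟩ˡ i)) (P.inverseʳ y))))
                   (P.inverseˡ x) }

  Sym : Group 0ℓ 0ℓ
  Sym = record { isGroup = isGroup }

  -- pointwise stabilizer in S_n of {k+1,…,n}, i.e. of the (0-based)
  -- indices i with k ≤ toℕ i; this is the subgroup S_k of S_n
  Stab : ℕ → Permutation′ n → Set
  Stab k σ = ∀ (i : Fin n) → k ≤ toℕ i → σ ⟨$⟩ʳ i ≡ i

{-# OPTIONS --safe #-}
module Submission where

-- Take as connection set the permutations g ∉ S_ℓ such that the g-cycle through each t ∈ [ℓ, m)
-- meets [0, m) only in t.  It is closed under inversion and under multiplication by S_ℓ on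
-- either side.  For y ∈ S_m, x⁻¹y lies in it exactly when y agrees on [ℓ, m) with the
-- first-return map of x on [0, m), i.e. y(t) is the first point of x(t), x²(t), … below m.
-- That map is itself a permutation in S_m (splice the points m, …, n-1 out of the cycles of
-- x one at a time), so every vertex xS_ℓ has a neighbour inside S_m, unique up to S_ℓ.

open import Level using (Level; _⊔_; 0ℓ)
open import Data.Nat using (ℕ; zero; suc; _+_; _≤_; _<_; s≤s; z<s; _<?_)
open import Data.Nat.Properties
  using (≤-trans; ≤-reflexive; <⇒≤; <⇒≢; >⇒≢; <⇒≱; ≤⇒≯; ≮⇒≥; n≤1+n; m<n⇒m<1+n; m<m+n;
         m≤n⇒m<n∨m≡n; +-suc; +-identityʳ; m+[n∸m]≡n)
open import Data.Fin using (Fin; toℕ; fromℕ<; _≟_)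
open import Data.Fin.Properties using (toℕ<n; toℕ-fromℕ<; toℕ-injective)
open import Data.Fin.Permutation as P using (Permutation′; _⟨$⟩ʳ_; _⟨$⟩ˡ_; _∘ₚ_)
import Data.Fin.Permutation.Components as PC
open import Data.Product using (Σ; ∃; _×_; _,_; proj₁; proj₂)
open import Data.Sum using (inj₁; inj₂)
open import Function.Bundles using (Injection)
open import Function.Properties.Inverse using (↔⇒↣)
open import Relation.Nullary using (¬_; yes; no; contradiction)
open import Relation.Unary using (Pred; _⊆_)
open import Relation.Binary.PropositionalEquality
  using (_≡_; _≢_; refl; sym; trans; cong; subst)
open import Algebra.Bundles using (Group)
open import Defs


module _ {c ℓ p : Level} (G : Group c ℓ) where
  open Group G
    using (Carrier; _∙_; _⁻¹; ε; inverseˡ; identityˡ; identityʳ)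
    renaming (sym to ≈-sym; trans to ≈-trans)
  open import Algebra.Properties.Group G using (⁻¹-involutive; \\-leftDividesˡ; //-rightDividesʳ)

  perfectCodeOfPair-criterion : {H A D : Carrier → Set p} →
    IsSubgroup G H → IsSubgroup G A → (∀ g → H g → A g) →
    (∀ g → DoubleCoset G H D g → D g) →
    (∀ g → D g → D (g ⁻¹)) →
    (∀ x → Σ Carrier λ y → A y × D (x ⁻¹ ∙ y)) →
    (∀ x y y′ → A y → A y′ → D (x ⁻¹ ∙ y) → D (x ⁻¹ ∙ y′) → H (y ⁻¹ ∙ y′)) →
    PerfectCodeOfPair G H A
  perfectCodeOfPair-criterion {H} {A} {D} H≤G A≤G H⊆A HDH⊆D D⁻¹⊆D meet unique =
    H≤G , A≤G , H⊆A , U , (λ _ → proj₂) , U⁻¹⊆U , perfect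
    where
    open IsSubgroup

    U : Carrier → Set p
    U g = D g × ¬ H g

    U⁻¹⊆U : ∀ g → U g → U (g ⁻¹)
    U⁻¹⊆U g (Dg , g∉H) =
      D⁻¹⊆D g Dg , λ g⁻¹∈H → g∉H (resp H≤G (⁻¹-involutive g) (⁻¹-closed H≤G g⁻¹∈H))

    ∈⇒coset⊆ : ∀ {y} → A y → CosetInside G H A y
    ∈⇒coset⊆ {y} y∈A g y⁻¹g∈H =
      resp A≤G (\\-leftDividesˡ y g) (∙-closed A≤G y∈A (H⊆A _ y⁻¹g∈H))

    coset⊆⇒∈ : ∀ {y} → CosetInside G H A y → A y
    coset⊆⇒∈ {y} yH⊆A = yH⊆A y (resp H≤G (≈-sym (inverseˡ y)) (ε∈ H≤G))

    adjacent⇒D : ∀ {x y} → Adj G H U x y → D (x ⁻¹ ∙ y)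
    adjacent⇒D (h₁ , u , h₂ , h₁∈H , (Du , _) , h₂∈H , eq) =
      HDH⊆D _ (h₁ , u , h₂ , h₁∈H , Du , h₂∈H , eq)

    perfect : IsPerfectCodeCos G H U (CosetInside G H A)
    perfect x xH⊈A = (y , ∈⇒coset⊆ y∈A , adjacent) , λ y y′ yH⊆A y′H⊆A adj adj′ →
      unique x y y′ (coset⊆⇒∈ yH⊆A) (coset⊆⇒∈ y′H⊆A) (adjacent⇒D adj) (adjacent⇒D adj′)
      where
      y = proj₁ (meet x)
      y∈A = proj₁ (proj₂ (meet x))

      x⁻¹y∉H : ¬ H (x ⁻¹ ∙ y)
      x⁻¹y∉H x⁻¹y∈H = xH⊈A (∈⇒coset⊆ (resp A≤G (⁻¹-involutive x) (⁻¹-closed A≤G x⁻¹∈A)))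
        where
        x⁻¹∈A : A (x ⁻¹)
        x⁻¹∈A = resp A≤G (//-rightDividesʳ y (x ⁻¹))
                  (∙-closed A≤G (H⊆A _ x⁻¹y∈H) (⁻¹-closed A≤G y∈A))

      adjacent : Adj G H U x y
      adjacent = ε , x ⁻¹ ∙ y , ε , ε∈ H≤G , (proj₂ (proj₂ (meet x)) , x⁻¹y∉H) , ε∈ H≤G ,
                 ≈-sym (≈-trans (identityʳ _) (identityˡ _))


module _ {a o : Level} {X : Set a} (O : Pred X o) (f : X → X) where

  data Excursion : X → X → Set (a ⊔ o) where
    hop : ∀ {p w} → f p ≡ w → Excursion p w
    via : ∀ {p w} → O (f p) → Excursion (f p) w → Excursion p w

module _ {a o : Level} {X : Set a} {O : Pred X o} {f : X → X} where

  via′ : ∀ {p q w} → f p ≡ q → O q → Excursion O f q w → Excursion O f p w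
  via′ refl = via

  excursion-++ : ∀ {p q w} → Excursion O f p q → O q → Excursion O f q w → Excursion O f p w
  excursion-++ (hop fp≡q) Oq e = via′ fp≡q Oq e
  excursion-++ (via Ofp e) Oq e′ = via Ofp (excursion-++ e Oq e′)

module _ {a o : Level} {X : Set a} {O : Pred X o} {f : X → X} where

  excursion-mono : ∀ {o′} {O′ : Pred X o′} {p w} → O ⊆ O′ →
    Excursion O f p w → Excursion O′ f p w
  excursion-mono _ (hop fp≡w) = hop fp≡w
  excursion-mono O⊆O′ (via Ofp e) = via (O⊆O′ Ofp) (excursion-mono O⊆O′ e)

  excursion-deterministic : ∀ {p w w′} → Excursion O f p w → Excursion O f p w′ →
    ¬ O w → ¬ O w′ → w ≡ w′
  excursion-deterministic (hop refl) (hop refl) _ _ = refl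
  excursion-deterministic (hop refl) (via Ofp _) ¬Ow _ = contradiction Ofp ¬Ow
  excursion-deterministic (via Ofp _) (hop refl) _ ¬Ow′ = contradiction Ofp ¬Ow′
  excursion-deterministic (via _ e) (via _ e′) = excursion-deterministic e e′

  excursion-reverse : ∀ {g : X → X} {p w} → (∀ q → g (f q) ≡ q) →
    Excursion O f p w → Excursion O g w p
  excursion-reverse g∘f≗id (hop refl) = hop (g∘f≗id _)
  excursion-reverse g∘f≗id (via Ofp e) =
    excursion-++ (excursion-reverse g∘f≗id e) Ofp (hop (g∘f≗id _))

  excursion-postcompose : ∀ {z f′ : X → X} {p w} → (∀ q → O q → z q ≡ q) →
    (∀ q → f′ q ≡ z (f q)) → Excursion O f p w → Excursion O f′ p (z w)
  excursion-postcompose _ f′≗z∘f (hop refl) = hop (f′≗z∘f _)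
  excursion-postcompose z-fix f′≗z∘f (via Ofp e) =
    via′ (trans (f′≗z∘f _) (z-fix _ Ofp)) Ofp (excursion-postcompose z-fix f′≗z∘f e)

  excursion-precompose : ∀ {z f′ : X → X} {p w} → (∀ q → O q → z q ≡ q) →
    (∀ q → f′ q ≡ f (z q)) → z p ≡ p → Excursion O f p w → Excursion O f′ p w
  excursion-precompose _ f′≗f∘z zp≡p (hop refl) = hop (trans (f′≗f∘z _) (cong f zp≡p))
  excursion-precompose z-fix f′≗f∘z zp≡p (via Ofp e) =
    via′ (trans (f′≗f∘z _) (cong f zp≡p)) Ofp
      (excursion-precompose z-fix f′≗f∘z (z-fix _ Ofp) e)


transpose-matchʳ : ∀ {n} (i j : Fin n) → PC.transpose i j j ≡ i
transpose-matchʳ i j with j ≟ i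
... | yes j≡i = j≡i
... | no _ with j ≟ j
...   | yes _ = refl
...   | no j≢j = contradiction refl j≢j

transpose-mismatch : ∀ {n} {i j k : Fin n} → k ≢ i → k ≢ j → PC.transpose i j k ≡ k
transpose-mismatch {i = i} {j} {k} k≢i k≢j with k ≟ i
... | yes k≡i = contradiction k≡i k≢i
... | no _ with k ≟ j
...   | yes k≡j = contradiction k≡j k≢j
...   | no _ = refl


Above : ∀ {n} → ℕ → Pred (Fin n) 0ℓ
Above r i = r ≤ toℕ i

module _ {n : ℕ} where

  Stab-isSubgroup : ∀ r → IsSubgroup (Sym n) (Stab n r)
  Stab-isSubgroup r = record
    { resp      = λ σ≈τ σ∈S i r≤i → trans (sym (σ≈τ i)) (σ∈S i r≤i)
    ; ε∈        = λ _ _ → refl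
    ; ∙-closed  = λ {σ} σ∈S τ∈S i r≤i → trans (cong (σ ⟨$⟩ʳ_) (τ∈S i r≤i)) (σ∈S i r≤i)
    ; ⁻¹-closed = λ {σ} σ∈S i r≤i → trans (cong (σ ⟨$⟩ˡ_) (sym (σ∈S i r≤i))) (P.inverseˡ σ)
    }

  Stab-mono : ∀ {r s} → r ≤ s → ∀ σ → Stab n r σ → Stab n s σ
  Stab-mono r≤s σ σ∈S i s≤i = σ∈S i (≤-trans r≤s s≤i)

  Stab-¬Above : ∀ {r} σ {i} → Stab n r σ → ¬ Above r i → ¬ Above r (σ ⟨$⟩ʳ i)
  Stab-¬Above σ σ∈S ¬r≤i r≤σi =
    ¬r≤i (subst (Above _) (Injection.injective (↔⇒↣ σ) (σ∈S _ r≤σi)) r≤σi)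


-- Removes the point r from its cycle: ⋯ ↦ p ↦ r ↦ z r ↦ ⋯ becomes ⋯ ↦ p ↦ z r ↦ ⋯ and r ↦ r.
spliceOut : ∀ {r n} → r < n → Permutation′ n → Permutation′ n
spliceOut r<n z = z ∘ₚ P.transpose (fromℕ< r<n) (z ⟨$⟩ʳ fromℕ< r<n)

module _ {n : ℕ} (x : Permutation′ n) where

  IsFirstReturn : ℕ → Permutation′ n → Set
  IsFirstReturn r y =
    Stab n r y × (∀ p → toℕ p < r → Excursion (Above r) (x ⟨$⟩ʳ_) p (y ⟨$⟩ʳ p))

  isFirstReturn-top : IsFirstReturn n x
  isFirstReturn-top = (λ p n≤p → contradiction (toℕ<n p) (≤⇒≯ n≤p)) , λ _ _ → hop refl

  isFirstReturn-splice : ∀ {r} (r<n : r < n) z → IsFirstReturn (suc r) z →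
    IsFirstReturn r (spliceOut r<n z)
  isFirstReturn-splice {r} r<n z (z-fix , z-exc) = fixes , excursions
    where
    q = fromℕ< r<n

    ≢q : ∀ {p} → toℕ p ≢ r → p ≢ q
    ≢q toℕp≢r p≡q = toℕp≢r (trans (cong toℕ p≡q) (toℕ-fromℕ< r<n))

    ≢zq : ∀ {p} → toℕ p ≢ r → z ⟨$⟩ʳ p ≢ z ⟨$⟩ʳ q
    ≢zq toℕp≢r zp≡zq = ≢q toℕp≢r (Injection.injective (↔⇒↣ z) zp≡zq)

    weaken : ∀ {p w} → Excursion (Above (suc r)) (x ⟨$⟩ʳ_) p w →
      Excursion (Above r) (x ⟨$⟩ʳ_) p w
    weaken = excursion-mono (≤-trans (n≤1+n r))

    fixes : Stab n r (spliceOut r<n z)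
    fixes p r≤p with m≤n⇒m<n∨m≡n r≤p
    ... | inj₁ r<p rewrite z-fix p r<p =
      transpose-mismatch (≢q (>⇒≢ r<p)) (λ p≡zq → ≢zq (>⇒≢ r<p) (trans (z-fix p r<p) p≡zq))
    ... | inj₂ r≡p with toℕ-injective (trans (toℕ-fromℕ< r<n) r≡p)
    ...   | refl = transpose-matchʳ q (z ⟨$⟩ʳ q)

    excursions : ∀ p → toℕ p < r →
      Excursion (Above r) (x ⟨$⟩ʳ_) p (spliceOut r<n z ⟨$⟩ʳ p)
    excursions p p<r with z ⟨$⟩ʳ p ≟ q
    ... | yes zp≡q =
      excursion-++ (weaken (subst (Excursion _ _ p) zp≡q (z-exc p (m<n⇒m<1+n p<r))))
                   (≤-reflexive (sym (toℕ-fromℕ< r<n)))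
                   (weaken (z-exc q (s≤s (≤-reflexive (toℕ-fromℕ< r<n)))))
    ... | no _ with z ⟨$⟩ʳ p ≟ z ⟨$⟩ʳ q
    ...   | yes zp≡zq = contradiction zp≡zq (≢zq (<⇒≢ p<r))
    ...   | no _ = weaken (z-exc p (m<n⇒m<1+n p<r))

  firstReturn-from : ∀ k r → r + k ≡ n → ∃ (IsFirstReturn r)
  firstReturn-from zero r r+0≡n rewrite +-identityʳ r | r+0≡n = x , isFirstReturn-top
  firstReturn-from (suc k) r r+1+k≡n
    with firstReturn-from k (suc r) (trans (sym (+-suc r k)) r+1+k≡n)
  ... | z , z-returns = spliceOut r<n z , isFirstReturn-splice r<n z z-returns
    where
    r<n : r < n
    r<n = subst (r <_) r+1+k≡n (m<m+n r z<s)

  firstReturn : ∀ {r} → r ≤ n → ∃ (IsFirstReturn r)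
  firstReturn r≤n = firstReturn-from _ _ (m+[n∸m]≡n r≤n)


module _ {n m : ℕ} (x y : Permutation′ n) (y∈S : Stab n m y) where
  open Group (Sym n) using (_∙_; _⁻¹)
  open IsSubgroup

  excursion⇒returning : ∀ {t} → Excursion (Above m) (x ⟨$⟩ʳ_) t (y ⟨$⟩ʳ t) →
    Excursion (Above m) ((x ⁻¹ ∙ y) ⟨$⟩ʳ_) t t
  excursion⇒returning e =
    excursion-reverse (λ _ → trans (cong (x ⟨$⟩ˡ_) (P.inverseʳ y)) (P.inverseˡ x))
      (subst (Excursion _ _ _) (P.inverseˡ y)
        (excursion-postcompose {z = y ⟨$⟩ˡ_} {f′ = (y ⁻¹ ∙ x) ⟨$⟩ʳ_}
          (⁻¹-closed (Stab-isSubgroup m) {y} y∈S) (λ _ → refl) e))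

  returning⇒excursion : ∀ {t} → Excursion (Above m) ((x ⁻¹ ∙ y) ⟨$⟩ʳ_) t t →
    Excursion (Above m) (x ⟨$⟩ʳ_) t (y ⟨$⟩ʳ t)
  returning⇒excursion e = excursion-postcompose y∈S (λ _ → sym (P.inverseʳ y))
    (excursion-reverse {g = (y ⁻¹ ∙ x) ⟨$⟩ʳ_}
      (λ _ → trans (cong (y ⟨$⟩ˡ_) (P.inverseʳ x)) (P.inverseˡ y)) e)

Returning : ∀ {n} → ℕ → ℕ → Permutation′ n → Set
Returning ℓ m g = ∀ t → ℓ ≤ toℕ t → toℕ t < m → Excursion (Above m) (g ⟨$⟩ʳ_) t t

module _ {n : ℕ} {ℓ m : ℕ} where
  open Group (Sym n) using (_∙_; _⁻¹)

  returning-⁻¹ : ∀ g → Returning ℓ m g → Returning ℓ m (g ⁻¹)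
  returning-⁻¹ g g-returns t ℓ≤t t<m =
    excursion-reverse (λ _ → P.inverseˡ g) (g-returns t ℓ≤t t<m)

  returning-doubleCoset : ℓ ≤ m → ∀ g →
    DoubleCoset (Sym n) (Stab n ℓ) (Returning ℓ m) g → Returning ℓ m g
  returning-doubleCoset ℓ≤m g (h₁ , u , h₂ , h₁∈S , u-returns , h₂∈S , g≈h₁uh₂) t ℓ≤t t<m =
    excursion-precompose (Stab-mono ℓ≤m h₂ h₂∈S) g≈h₁uh₂ (h₂∈S t ℓ≤t)
      (subst (Excursion _ _ t) (h₁∈S t ℓ≤t)
        (excursion-postcompose (Stab-mono ℓ≤m h₁ h₁∈S) (λ _ → refl) (u-returns t ℓ≤t t<m)))

  returning-exists : m ≤ n → ∀ x →
    Σ (Permutation′ n) λ y → Stab n m y × Returning ℓ m (x ⁻¹ ∙ y)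
  returning-exists m≤n x with firstReturn x m≤n
  ... | y , y∈S , y-excursions =
    y , y∈S , λ t _ t<m → excursion⇒returning x y y∈S (y-excursions t t<m)

  returning-unique : ∀ x y y′ → Stab n m y → Stab n m y′ →
    Returning ℓ m (x ⁻¹ ∙ y) → Returning ℓ m (x ⁻¹ ∙ y′) → Stab n ℓ (y ⁻¹ ∙ y′)
  returning-unique x y y′ y∈S y′∈S y-returns y′-returns i ℓ≤i =
    trans (cong (y ⟨$⟩ˡ_) (sym yi≡y′i)) (P.inverseˡ y)
    where
    yi≡y′i : y ⟨$⟩ʳ i ≡ y′ ⟨$⟩ʳ i
    yi≡y′i with toℕ i <? m
    ... | yes i<m = excursion-deterministic
      (returning⇒excursion x y y∈S (y-returns i ℓ≤i i<m))
      (returning⇒excursion x y′ y′∈S (y′-returns i ℓ≤i i<m))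
      (Stab-¬Above y y∈S (<⇒≱ i<m)) (Stab-¬Above y′ y′∈S (<⇒≱ i<m))
    ... | no i≮m = trans (y∈S i (≮⇒≥ i≮m)) (sym (y′∈S i (≮⇒≥ i≮m)))


-- The hypothesis 0 < ℓ is unused: the argument works equally for the trivial subgroup S_0.
proposition1p9 : (ℓ m n : ℕ) → 0 < ℓ → ℓ < m → m < n →
    PerfectCodeOfPair (Sym n) (Stab n ℓ) (Stab n m)
proposition1p9 ℓ m n _ ℓ<m m<n =
  perfectCodeOfPair-criterion (Sym n) (Stab-isSubgroup ℓ) (Stab-isSubgroup m) (Stab-mono ℓ≤m)
    (returning-doubleCoset ℓ≤m) returning-⁻¹ (returning-exists (<⇒≤ m<n))
    returning-unique
  where
  ℓ≤m : ℓ ≤ m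
  ℓ≤m = <⇒≤ ℓ<m
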